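{- Let $q\ge2$ and $n$ be positive integers with $q\mid n$. For any composition $\boldsymbol{r}=(r_0,\dots,r_{q-1})$ of $n$ (nonnegative integers summing to $n$), if $\sum_{i=0}^{q-1} i r_i\not\equiv 0\pmod q$, then $K^{(\mathbb{Z}_q)}_{\boldsymbol{n/q}}(\boldsymbol{r})=0$.
   Context: For $x\in\mathbb{Z}_q^n$, $\operatorname{comp}(x)=(r_0,\dots,r_{q-1})$ where $r_g$ is the number of coordinates of $x$ equal to $g$. Let $S_{\boldsymbol{n/q}}=\{x\in\mathbb{Z}_q^n:\operatorname{comp}(x)=(n/q,\dots,n/q)\}$ and $\zeta_q=e^{2\pi i/q}$. For a composition $\boldsymbol r$, $K^{(\mathbb{Z}_q)}_{\boldsymbol{n/q}}(\boldsymbol{r})=\sum_{y\in S_{\boldsymbol{n/q}}}\zeta_q^{a\cdot y}$ for any $a\in\mathbb{Z}_q^n$ with $\operatorname{comp}(a)=\boldsymbol{r}$ (independent of the choice of $a$), where $a\cdot y=\sum_k a_ky_k$; equivalently it is the coefficient of $\prod_g z_g^{n/q}$ in $\prod_{h\in\mathbb{Z}_q}\big(\sum_{g\in\mathbb{Z}_q}\zeta_q^{hg}z_g\big)^{r_h}$. These are the eigenvalues of the generalized Hadamard graph $\varOmega_n^{(\mathbb{Z}_q)}$. -}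

module Defs where

open import Level using (Level)
open import Data.Nat using (ℕ; zero; suc)
import Data.Nat as ℕ
import Data.Nat.Properties as ℕP
open import Data.Fin using (Fin; toℕ)
import Data.Fin.Properties as FinP
open import Data.Vec using (Vec; []; _∷_; tabulate; count; replicate; zipWith)
import Data.Vec as Vec
open import Data.Vec.Properties using (≡-dec)
open import Data.List using (List; []; _∷_; concatMap; map; filter; allFin)
open import Relation.Nullary using (¬_)
open import Algebra.Bundles using (CommutativeRing)

allVecs : (q n : ℕ) → List (Vec (Fin q) n)
allVecs q zero = [] ∷ []
allVecs q (suc n) = concatMap (λ g → map (g ∷_) (allVecs q n)) (allFin q)

comp : ∀ {q n} → Vec (Fin q) n → Vec ℕ q
comp {q} x = tabulate (λ g → count (g FinP.≟_) x)

S : (q n k : ℕ) → List (Vec (Fin q) n)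
S q n k = filter (λ y → ≡-dec ℕP._≟_ (comp y) (replicate q k)) (allVecs q n)

-- a · y = Σ_k a_k y_k (as a natural number; only its residue mod q matters
-- since ζ^q = 1)
dot : ∀ {q n} → Vec (Fin q) n → Vec (Fin q) n → ℕ
dot a y = Vec.sum (zipWith (λ u v → toℕ u ℕ.* toℕ v) a y)

weight : ∀ {q} → Vec ℕ q → ℕ
weight {q} r = Vec.sum (tabulate (λ i → toℕ i ℕ.* Vec.lookup r i))

module _ {c ℓ : Level} (R : CommutativeRing c ℓ) where
  open CommutativeRing R

  pow : Carrier → ℕ → Carrier
  pow x zero = 1#
  pow x (suc m) = x * pow x m

  sumR : List Carrier → Carrier
  sumR [] = 0#
  sumR (x ∷ xs) = x + sumR xs

  IsPrimitiveRoot : ℕ → Carrier → Set ℓ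
  IsPrimitiveRoot q ζ = (pow ζ q ≈ 1#) × (∀ j → 0 ℕ.< j → j ℕ.< q → ¬ (pow ζ j ≈ 1#))
    where open import Data.Product using (_×_)

  NoZeroDivisors : Set (c Level.⊔ ℓ)
  NoZeroDivisors = ∀ x y → x * y ≈ 0# → (x ≈ 0#) ⊎ (y ≈ 0#)
    where open import Data.Sum using (_⊎_)

  -- K_{k}(comp a) = Σ_{y ∈ S_k} ζ^{a·y}
  K : ∀ {q n} → Carrier → ℕ → Vec (Fin q) n → Carrier
  K {q} {n} ζ k a = sumR (map (λ y → pow ζ (dot a y)) (S q n k))

-- The coordinatewise cyclic shift σ y = y − (1,…,1) only relabels the symbols
-- of y, so it permutes S_{n/q}; and a·(σ y) ≡ a·y − Σ_k a_k (mod q), where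
-- Σ_k a_k = Σ_i i r_i =: w.  Reindexing the sum K by σ therefore gives
-- K = ζ^w K.  As q ∤ w and ζ is a primitive q-th root of unity, ζ^w ≠ 1, and
-- in a ring without zero divisors (ζ^w − 1) K = 0 forces K = 0.
module Submission where

open import Defs
open import Level using (Level)
open import Data.Nat using (ℕ; _≤_; _<_; _/_; NonZero)
open import Data.Nat.Divisibility using (_∣_)
open import Data.Fin using (Fin)
open import Data.Vec using (Vec; sum)
open import Relation.Nullary using (¬_)
open import Relation.Binary.PropositionalEquality using (_≡_)
open import Algebra.Bundles using (CommutativeRing)

open import Data.Nat using (zero; suc; _%_)
open import Data.Nat.DivMod using (%-distribˡ-+; m*n%n≡0; m≡m%n+[m/n]*n; m%n<n; m%n%n≡m%n)
open import Data.Nat.Divisibility using (m%n≡0⇒n∣m)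
open import Data.Fin using (zero; suc; toℕ; fromℕ; inject₁)
open import Data.Fin.Properties using (_≟_; fromℕ≢inject₁; inject₁-injective; toℕ-fromℕ; toℕ-inject₁)
open import Data.Vec using ([]; _∷_; map; count; tabulate; replicate; lookup)
open import Data.Vec.Properties using (lookup∘tabulate; lookup-replicate; tabulate-cong; ≡-dec)
import Data.Nat.Properties
open import Data.List as List using (List; []; _∷_; _++_; filter; allFin)
open import Data.List.Properties using (map-∘; map-tabulate)
open import Data.Product using (∃; _,_; proj₁)
open import Data.Sum using (inj₁; inj₂)
open import Data.Empty using (⊥-elim)
open import Data.Bool using (if_then_else_)
open import Relation.Nullary using (Dec; yes; no; does)
open import Relation.Unary using (Pred; Decidable)
open import Relation.Binary.PropositionalEquality using (refl; sym; trans; cong; cong₂; subst; module ≡-Reasoning)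
open import Function using (_∘_; id; _⇔_; mk⇔; Equivalence)
open import Function.Definitions using (Injective)

module _ where
  open import Data.Nat using (_+_; _*_)
  import Data.Nat.Properties as ℕ
  open import Algebra.Properties.CommutativeSemigroup ℕ.+-commutativeSemigroup using (interchange)
  open import Algebra.Properties.Semiring.Sum ℕ.+-*-semiring
    using (sum-syntax; ∑-distrib-+; sum-cong-≗; sum-replicate-zero)

  cyclicPred : ∀ {m} → Fin (suc m) → Fin (suc m)
  cyclicPred {m} zero = fromℕ m
  cyclicPred (suc i) = inject₁ i

  cyclicPred-injective : ∀ {m} → Injective _≡_ _≡_ (cyclicPred {m})
  cyclicPred-injective {x = zero}  {zero}  _ = refl
  cyclicPred-injective {x = zero}  {suc j} e = ⊥-elim (fromℕ≢inject₁ e)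
  cyclicPred-injective {x = suc i} {zero}  e = ⊥-elim (fromℕ≢inject₁ (sym e))
  cyclicPred-injective {x = suc i} {suc j} e = cong suc (inject₁-injective e)

  cyclicPred-surjective : ∀ {m} (h : Fin (suc m)) → ∃ λ g → cyclicPred g ≡ h
  cyclicPred-surjective {zero}  zero = zero , refl
  cyclicPred-surjective {suc m} zero = suc zero , refl
  cyclicPred-surjective {suc m} (suc h) with cyclicPred-surjective h
  ... | zero  , refl = zero , refl
  ... | suc i , refl = suc (suc i) , refl

  count-map-injective : ∀ {q n} {π : Fin q → Fin q} → Injective _≡_ _≡_ π →
                        ∀ g (y : Vec (Fin q) n) → count (π g ≟_) (map π y) ≡ count (g ≟_) y
  count-map-injective inj g [] = refl
  count-map-injective {π = π} inj g (u ∷ y) with π g ≟ π u | g ≟ u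
  ... | yes _     | yes _    = cong suc (count-map-injective inj g y)
  ... | no _      | no _     = count-map-injective inj g y
  ... | yes πg≡πu | no g≢u   = ⊥-elim (g≢u (inj πg≡πu))
  ... | no πg≢πu  | yes refl = ⊥-elim (πg≢πu refl)

  tabulate≡replicate⇔ : ∀ {A : Set} {n} (f : Fin n → A) x → tabulate f ≡ replicate n x ⇔ (∀ i → f i ≡ x)
  tabulate≡replicate⇔ {n = n} f x = mk⇔ to from
    where
    to : tabulate f ≡ replicate n x → ∀ i → f i ≡ x
    to e i = trans (sym (lookup∘tabulate f i)) (trans (cong (λ v → lookup v i) e) (lookup-replicate i x))
    const≡replicate : ∀ n → tabulate {n = n} (λ _ → x) ≡ replicate n x
    const≡replicate zero = refl
    const≡replicate (suc n) = cong (x ∷_) (const≡replicate n)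
    from : (∀ i → f i ≡ x) → tabulate f ≡ replicate n x
    from e = trans (tabulate-cong e) (const≡replicate n)

  comp-map-uniform : ∀ {q n k} {π : Fin q → Fin q} → Injective _≡_ _≡_ π → (∀ h → ∃ λ g → π g ≡ h) →
                     (y : Vec (Fin q) n) → comp y ≡ replicate q k ⇔ comp (map π y) ≡ replicate q k
  comp-map-uniform {q} {n} {k} {π} inj surj y = mk⇔ forward backward
    where
    open Equivalence
    uniform⇔ : (z : Vec (Fin q) n) → comp z ≡ replicate q k ⇔ (∀ g → count (g ≟_) z ≡ k)
    uniform⇔ z = tabulate≡replicate⇔ (λ g → count (g ≟_) z) k
    forward : comp y ≡ replicate q k → comp (map π y) ≡ replicate q k
    forward e = from (uniform⇔ (map π y)) image
      where
      image : ∀ h → count (h ≟_) (map π y) ≡ k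
      image h with surj h
      ... | g , refl = trans (count-map-injective inj g y) (to (uniform⇔ y) e g)
    backward : comp (map π y) ≡ replicate q k → comp y ≡ replicate q k
    backward e = from (uniform⇔ y) λ g →
      trans (sym (count-map-injective inj g y)) (to (uniform⇔ (map π y)) e (π g))

  coordinateSum : ∀ {q n} → Vec (Fin q) n → ℕ
  coordinateSum a = sum (map toℕ a)

  *-cyclicPred-% : ∀ {m} x (g : Fin (suc m)) → (x * toℕ g) % suc m ≡ (x * toℕ (cyclicPred g) + x) % suc m
  *-cyclicPred-% {m} x zero = begin
    (x * 0) % suc m                  ≡⟨ cong (_% suc m) (ℕ.*-zeroʳ x) ⟩
    0                                ≡⟨ m*n%n≡0 x (suc m) ⟨
    (x * suc m) % suc m              ≡⟨ cong (_% suc m) (trans (ℕ.*-suc x m) (ℕ.+-comm x (x * m))) ⟩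
    (x * m + x) % suc m              ≡⟨ cong (λ t → (x * t + x) % suc m) (toℕ-fromℕ m) ⟨
    (x * toℕ (fromℕ m) + x) % suc m  ∎
    where open ≡-Reasoning
  *-cyclicPred-% {m} x (suc i) = cong (_% suc m) (begin
    x * suc (toℕ i)        ≡⟨ ℕ.*-suc x (toℕ i) ⟩
    x + x * toℕ i          ≡⟨ ℕ.+-comm x _ ⟩
    x * toℕ i + x          ≡⟨ cong (λ t → x * t + x) (toℕ-inject₁ i) ⟨
    x * toℕ (inject₁ i) + x ∎)
    where open ≡-Reasoning

  dot-map-cyclicPred : ∀ {m n} (a y : Vec (Fin (suc m)) n) →
                       dot a y % suc m ≡ (dot a (map cyclicPred y) + coordinateSum a) % suc m
  dot-map-cyclicPred [] [] = refl
  dot-map-cyclicPred {m} (x ∷ a) (g ∷ y) = begin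
    (toℕ x * toℕ g + dot a y) % q
      ≡⟨ %-distribˡ-+ (toℕ x * toℕ g) (dot a y) q ⟩
    ((toℕ x * toℕ g) % q + dot a y % q) % q
      ≡⟨ cong₂ (λ u v → (u + v) % q) (*-cyclicPred-% (toℕ x) g) (dot-map-cyclicPred a y) ⟩
    ((toℕ x * toℕ g′ + toℕ x) % q + (dot a y′ + coordinateSum a) % q) % q
      ≡⟨ %-distribˡ-+ (toℕ x * toℕ g′ + toℕ x) (dot a y′ + coordinateSum a) q ⟨
    ((toℕ x * toℕ g′ + toℕ x) + (dot a y′ + coordinateSum a)) % q
      ≡⟨ cong (_% q) (interchange (toℕ x * toℕ g′) (toℕ x) (dot a y′) (coordinateSum a)) ⟩
    ((toℕ x * toℕ g′ + dot a y′) + (toℕ x + coordinateSum a)) % q ∎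
    where
    open ≡-Reasoning
    q = suc m
    g′ = cyclicPred g
    y′ = map cyclicPred y

  sum-tabulate : ∀ {n} (f : Fin n → ℕ) → sum (tabulate f) ≡ ∑[ i < n ] f i
  sum-tabulate {zero}  f = refl
  sum-tabulate {suc n} f = cong (f zero +_) (sum-tabulate (f ∘ suc))

  ∑-indicator : ∀ {q} (f : Fin q → ℕ) x → ∑[ i < q ] (if does (i ≟ x) then f i else 0) ≡ f x
  ∑-indicator {suc q} f zero    = trans (cong (f zero +_) (sum-replicate-zero q)) (ℕ.+-identityʳ (f zero))
  ∑-indicator {suc q} f (suc x) = ∑-indicator (f ∘ suc) x

  *-count-∷ : ∀ {q n} (i x : Fin q) (a : Vec (Fin q) n) →
              toℕ i * count (i ≟_) (x ∷ a) ≡ toℕ i * count (i ≟_) a + (if does (i ≟ x) then toℕ i else 0)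
  *-count-∷ i x a with i ≟ x
  ... | yes _ = trans (ℕ.*-suc (toℕ i) _) (ℕ.+-comm (toℕ i) _)
  ... | no _  = sym (ℕ.+-identityʳ _)

  ∑-*-count : ∀ {q n} (a : Vec (Fin q) n) → ∑[ i < q ] (toℕ i * count (i ≟_) a) ≡ coordinateSum a
  ∑-*-count {q} [] = trans (sum-cong-≗ {n = q} (ℕ.*-zeroʳ ∘ toℕ)) (sum-replicate-zero q)
  ∑-*-count {q} (x ∷ a) = begin
    ∑[ i < q ] (toℕ i * count (i ≟_) (x ∷ a))
      ≡⟨ sum-cong-≗ (λ i → *-count-∷ i x a) ⟩
    ∑[ i < q ] (toℕ i * count (i ≟_) a + (if does (i ≟ x) then toℕ i else 0))
      ≡⟨ ∑-distrib-+ {q} _ _ ⟩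
    ∑[ i < q ] (toℕ i * count (i ≟_) a) + ∑[ i < q ] (if does (i ≟ x) then toℕ i else 0)
      ≡⟨ cong₂ _+_ (∑-*-count a) (∑-indicator toℕ x) ⟩
    coordinateSum a + toℕ x
      ≡⟨ ℕ.+-comm _ (toℕ x) ⟩
    toℕ x + coordinateSum a ∎
    where open ≡-Reasoning

  weight-comp : ∀ {q n} (a : Vec (Fin q) n) → weight (comp a) ≡ coordinateSum a
  weight-comp {q} a = begin
    weight (comp a)                         ≡⟨ sum-tabulate {q} _ ⟩
    ∑[ i < q ] (toℕ i * lookup (comp a) i)
      ≡⟨ sum-cong-≗ {q} (λ i → cong (toℕ i *_) (lookup∘tabulate _ i)) ⟩
    ∑[ i < q ] (toℕ i * count (i ≟_) a)     ≡⟨ ∑-*-count a ⟩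
    coordinateSum a                         ∎
    where open ≡-Reasoning

module _ {c ℓ} (R : CommutativeRing c ℓ) where
  import Data.Nat as ℕ
  open import Data.Nat.Properties using (n≢0⇒n>0)
  open CommutativeRing R renaming (refl to ≈-refl; sym to ≈-sym; trans to ≈-trans)
  open import Algebra.Properties.Semiring.Exp semiring using (_^_; ^-homo-*; ^-congʳ)
  open import Algebra.Properties.Semiring.Sum semiring using (sum-syntax; sum-cong-≋; *-distribˡ-sum; sum-init-last)
  open import Algebra.Properties.Ring ring using (-1*x≈-x)
  open import Algebra.Properties.Group +-group using (x∙y⁻¹≈ε⇒x≈y)
  open import Relation.Binary.Reasoning.Setoid setoid

  pow≡^ : ∀ x m → pow R x m ≡ x ^ m
  pow≡^ x zero    = refl
  pow≡^ x (suc m) = cong (x *_) (pow≡^ x m)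

  module _ {x : Carrier} (q : ℕ) .{{_ : NonZero q}} (x^q≈1 : x ^ q ≈ 1#) where

    ^-*≈1 : ∀ k → x ^ (k ℕ.* q) ≈ 1#
    ^-*≈1 zero    = ≈-refl
    ^-*≈1 (suc k) = begin
      x ^ (q ℕ.+ k ℕ.* q)     ≈⟨ ^-homo-* x q (k ℕ.* q) ⟩
      x ^ q * x ^ (k ℕ.* q)   ≈⟨ *-cong x^q≈1 (^-*≈1 k) ⟩
      1# * 1#                 ≈⟨ *-identityˡ 1# ⟩
      1#                      ∎

    ^-% : ∀ m → x ^ m ≈ x ^ (m % q)
    ^-% m = begin
      x ^ m                             ≈⟨ ^-congʳ x (m≡m%n+[m/n]*n m q) ⟩
      x ^ (m % q ℕ.+ (m / q) ℕ.* q)     ≈⟨ ^-homo-* x (m % q) _ ⟩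
      x ^ (m % q) * x ^ ((m / q) ℕ.* q) ≈⟨ *-congˡ (^-*≈1 (m / q)) ⟩
      x ^ (m % q) * 1#                  ≈⟨ *-identityʳ _ ⟩
      x ^ (m % q)                       ∎

  pow-cong-% : ∀ {x} q .{{_ : NonZero q}} → pow R x q ≈ 1# → ∀ m n → m % q ≡ n % q → pow R x m ≈ pow R x n
  pow-cong-% {x} q x^q≈1 m n m≡n = begin
    pow R x m    ≡⟨ pow≡^ x m ⟩
    x ^ m        ≈⟨ ^-% q x^q≈1′ m ⟩
    x ^ (m % q)  ≡⟨ cong (x ^_) m≡n ⟩
    x ^ (n % q)  ≈⟨ ^-% q x^q≈1′ n ⟨
    x ^ n        ≡⟨ pow≡^ x n ⟨
    pow R x n    ∎
    where
    x^q≈1′ : x ^ q ≈ 1#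
    x^q≈1′ = ≈-trans (reflexive (sym (pow≡^ x q))) x^q≈1

  primitiveRoot-pow≈1⇒∣ : ∀ {ζ q} .{{_ : NonZero q}} → IsPrimitiveRoot R q ζ → ∀ m → pow R ζ m ≈ 1# → q ∣ m
  primitiveRoot-pow≈1⇒∣ {ζ} {q} (ζ^q≈1 , minimal) m ζ^m≈1 with m % q ℕ.≟ 0
  ... | yes m%q≡0 = m%n≡0⇒n∣m m q m%q≡0
  ... | no m%q≢0  = ⊥-elim (minimal (m % q) (n≢0⇒n>0 m%q≢0) (m%n<n m q)
                      (≈-trans (pow-cong-% q ζ^q≈1 (m % q) m (m%n%n≡m%n m q)) ζ^m≈1))

  pow-dot-map-cyclicPred : ∀ {ζ m n} → pow R ζ (suc m) ≈ 1# → (a y : Vec (Fin (suc m)) n) →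
                           pow R ζ (dot a y) ≈ pow R ζ (coordinateSum a) * pow R ζ (dot a (map cyclicPred y))
  pow-dot-map-cyclicPred {ζ} {m} ζ^q≈1 a y = begin
    pow R ζ (dot a y)
      ≈⟨ pow-cong-% (suc m) ζ^q≈1 (dot a y) (dot a y′ ℕ.+ coordinateSum a) (dot-map-cyclicPred a y) ⟩
    pow R ζ (dot a y′ ℕ.+ coordinateSum a)  ≡⟨ pow≡^ ζ (dot a y′ ℕ.+ coordinateSum a) ⟩
    ζ ^ (dot a y′ ℕ.+ coordinateSum a)      ≈⟨ ^-homo-* ζ (dot a y′) (coordinateSum a) ⟩
    ζ ^ dot a y′ * ζ ^ coordinateSum a      ≈⟨ *-comm _ _ ⟩
    ζ ^ coordinateSum a * ζ ^ dot a y′      ≡⟨ cong₂ _*_ (pow≡^ ζ (coordinateSum a)) (pow≡^ ζ (dot a y′)) ⟨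
    pow R ζ (coordinateSum a) * pow R ζ (dot a y′) ∎
    where y′ = map cyclicPred y

  x≈c*x⇒x≈0 : NoZeroDivisors R → ∀ {c x} → ¬ (c ≈ 1#) → x ≈ c * x → x ≈ 0#
  x≈c*x⇒x≈0 noZeroDivisors {c} {x} c≉1 x≈cx with noZeroDivisors (c - 1#) x [c-1]x≈0
    where
    [c-1]x≈0 : (c - 1#) * x ≈ 0#
    [c-1]x≈0 = begin
      (c - 1#) * x        ≈⟨ distribʳ x c (- 1#) ⟩
      c * x + - 1# * x    ≈⟨ +-cong (≈-sym x≈cx) (-1*x≈-x x) ⟩
      x - x               ≈⟨ -‿inverseʳ x ⟩
      0#                  ∎
  ... | inj₁ c-1≈0 = ⊥-elim (c≉1 (x∙y⁻¹≈ε⇒x≈y c 1# c-1≈0))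
  ... | inj₂ x≈0   = x≈0

  if-cong-⇔ : ∀ {p p′} {P : Set p} {P′ : Set p′} (P? : Dec P) (P′? : Dec P′) → P ⇔ P′ →
              ∀ {c x x′} → x ≈ c * x′ → (if does P? then x else 0#) ≈ c * (if does P′? then x′ else 0#)
  if-cong-⇔ (yes _) (yes _) _    x≈cx′ = x≈cx′
  if-cong-⇔ (no _)  (no _)  _    _     = ≈-sym (zeroʳ _)
  if-cong-⇔ (yes p) (no ¬p′) P⇔P′ _    = ⊥-elim (¬p′ (Equivalence.to P⇔P′ p))
  if-cong-⇔ (no ¬p) (yes p′) P⇔P′ _    = ⊥-elim (¬p (Equivalence.from P⇔P′ p′))

  ∑-cyclicPred : ∀ {m} (G : Fin (suc m) → Carrier) → ∑[ g < suc m ] G (cyclicPred g) ≈ ∑[ g < suc m ] G g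
  -- The left-hand side is definitionally G (fromℕ m) + ∑[ i < m ] G (inject₁ i).
  ∑-cyclicPred G = ≈-trans (+-comm _ _) (≈-sym (sum-init-last G))

  ∑ⱽ : ∀ q n → (Vec (Fin q) n → Carrier) → Carrier
  ∑ⱽ q zero    F = F []
  ∑ⱽ q (suc n) F = ∑[ g < q ] ∑ⱽ q n (λ y → F (g ∷ y))

  ∑ⱽ-cong : ∀ q n {F G : Vec (Fin q) n → Carrier} → (∀ y → F y ≈ G y) → ∑ⱽ q n F ≈ ∑ⱽ q n G
  ∑ⱽ-cong q zero    F≈G = F≈G []
  ∑ⱽ-cong q (suc n) F≈G = sum-cong-≋ λ g → ∑ⱽ-cong q n (λ y → F≈G (g ∷ y))

  *-distribˡ-∑ⱽ : ∀ q n x (F : Vec (Fin q) n → Carrier) → x * ∑ⱽ q n F ≈ ∑ⱽ q n (λ y → x * F y)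
  *-distribˡ-∑ⱽ q zero    x F = ≈-refl
  *-distribˡ-∑ⱽ q (suc n) x F = ≈-trans (*-distribˡ-sum {q} x _)
                                        (sum-cong-≋ {q} λ g → *-distribˡ-∑ⱽ q n x (λ y → F (g ∷ y)))

  ∑ⱽ-map : ∀ {q} (π : Fin q → Fin q) → (∀ G → ∑[ g < q ] G (π g) ≈ ∑[ g < q ] G g) →
           ∀ n (F : Vec (Fin q) n → Carrier) → ∑ⱽ q n (F ∘ map π) ≈ ∑ⱽ q n F
  ∑ⱽ-map π ∑-π zero    F = ≈-refl
  ∑ⱽ-map π ∑-π (suc n) F = ≈-trans (sum-cong-≋ λ g → ∑ⱽ-map π ∑-π n (λ y → F (π g ∷ y)))
                                 (∑-π (λ h → ∑ⱽ _ n (λ y → F (h ∷ y))))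

  ∑ˡ : {A : Set} → (A → Carrier) → List A → Carrier
  ∑ˡ f xs = sumR R (List.map f xs)

  ∑ˡ-cong : ∀ {A : Set} {f g : A → Carrier} → (∀ x → f x ≈ g x) → ∀ xs → ∑ˡ f xs ≈ ∑ˡ g xs
  ∑ˡ-cong f≈g []       = ≈-refl
  ∑ˡ-cong f≈g (x ∷ xs) = +-cong (f≈g x) (∑ˡ-cong f≈g xs)

  ∑ˡ-++ : ∀ {A : Set} (f : A → Carrier) xs ys → ∑ˡ f (xs ++ ys) ≈ ∑ˡ f xs + ∑ˡ f ys
  ∑ˡ-++ f []       ys = ≈-sym (+-identityˡ _)
  ∑ˡ-++ f (x ∷ xs) ys = ≈-trans (+-congˡ (∑ˡ-++ f xs ys)) (≈-sym (+-assoc _ _ _))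

  ∑ˡ-concatMap : ∀ {A B : Set} (f : B → Carrier) (h : A → List B) xs →
                 ∑ˡ f (List.concatMap h xs) ≈ ∑ˡ (λ x → ∑ˡ f (h x)) xs
  ∑ˡ-concatMap f h []       = ≈-refl
  ∑ˡ-concatMap f h (x ∷ xs) = ≈-trans (∑ˡ-++ f (h x) _) (+-congˡ (∑ˡ-concatMap f h xs))

  ∑ˡ-map : ∀ {A B : Set} (f : B → Carrier) (h : A → B) xs → ∑ˡ f (List.map h xs) ≡ ∑ˡ (f ∘ h) xs
  ∑ˡ-map f h xs = cong (sumR R) (sym (map-∘ xs))

  ∑ˡ-allFin : ∀ n (G : Fin n → Carrier) → ∑ˡ G (allFin n) ≈ ∑[ i < n ] G i
  ∑ˡ-allFin n G = ≈-trans (reflexive (cong (sumR R) (map-tabulate id G))) (sumR-tabulate n G)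
    where
    sumR-tabulate : ∀ n (G : Fin n → Carrier) → sumR R (List.tabulate G) ≈ ∑[ i < n ] G i
    sumR-tabulate zero    G = ≈-refl
    sumR-tabulate (suc n) G = +-congˡ (sumR-tabulate n (G ∘ suc))

  ∑ˡ-allVecs : ∀ q n (F : Vec (Fin q) n → Carrier) → ∑ˡ F (allVecs q n) ≈ ∑ⱽ q n F
  ∑ˡ-allVecs q zero    F = +-identityʳ (F [])
  ∑ˡ-allVecs q (suc n) F = begin
    ∑ˡ F (List.concatMap (λ g → List.map (g ∷_) (allVecs q n)) (allFin q))
      ≈⟨ ∑ˡ-concatMap F _ (allFin q) ⟩
    ∑ˡ (λ g → ∑ˡ F (List.map (g ∷_) (allVecs q n))) (allFin q)
      ≈⟨ ∑ˡ-cong (λ g → ≈-trans (reflexive (∑ˡ-map F (g ∷_) (allVecs q n)))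
                                (∑ˡ-allVecs q n (λ y → F (g ∷ y)))) (allFin q) ⟩
    ∑ˡ (λ g → ∑ⱽ q n (λ y → F (g ∷ y))) (allFin q)
      ≈⟨ ∑ˡ-allFin q _ ⟩
    ∑ⱽ q (suc n) F ∎

  ∑ˡ-filter : ∀ {A : Set} {p} {P : Pred A p} (P? : Decidable P) (f : A → Carrier) xs →
              ∑ˡ f (filter P? xs) ≈ ∑ˡ (λ x → if does (P? x) then f x else 0#) xs
  ∑ˡ-filter P? f []       = ≈-refl
  ∑ˡ-filter P? f (x ∷ xs) with P? x
  ... | yes _ = +-congˡ (∑ˡ-filter P? f xs)
  ... | no _  = ≈-trans (∑ˡ-filter P? f xs) (≈-sym (+-identityˡ _))

lemma4p2 : ∀ {c ℓ : Level} (R : CommutativeRing c ℓ) → NoZeroDivisors R →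
           (ζ : CommutativeRing.Carrier R) →
           (q n : ℕ) .{{_ : NonZero q}} → 2 ≤ q → 0 < n → q ∣ n → IsPrimitiveRoot R q ζ →
           (r : Vec ℕ q) → sum r ≡ n → ¬ (q ∣ weight r) →
           (a : Vec (Fin q) n) → comp a ≡ r →
           CommutativeRing._≈_ R (K R ζ (n / q) a) (CommutativeRing.0# R)
lemma4p2 R noZeroDivisors ζ q@(suc m) n _ _ _ isPrimitive r _ q∤weight a refl = begin
  K R ζ (n / q) a        ≈⟨ ∑ˡ-filter R uniform? (λ y → pow R ζ (dot a y)) (allVecs q n) ⟩
  ∑ˡ R T (allVecs q n)   ≈⟨ ∑ˡ-allVecs R q n T ⟩
  ∑ⱽ R q n T             ≈⟨ x≈c*x⇒x≈0 R noZeroDivisors ζ^w≉1 ∑T≈ζ^w*∑T ⟩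
  0#                     ∎
  where
  open CommutativeRing R using (Carrier; _≈_; _*_; 0#; 1#; *-congˡ; setoid)
  open import Relation.Binary.Reasoning.Setoid setoid
  uniform? : (y : Vec (Fin q) n) → Dec (comp y ≡ replicate q (n / q))
  uniform? y = ≡-dec Data.Nat.Properties._≟_ (comp y) (replicate q (n / q))
  T : Vec (Fin q) n → Carrier
  T y = if does (uniform? y) then pow R ζ (dot a y) else 0#
  σ : Vec (Fin q) n → Vec (Fin q) n
  σ = map cyclicPred
  w : ℕ
  w = coordinateSum a
  ζ^w≉1 : ¬ (pow R ζ w ≈ 1#)
  ζ^w≉1 ζ^w≈1 = q∤weight (subst (q ∣_) (sym (weight-comp a)) (primitiveRoot-pow≈1⇒∣ R isPrimitive w ζ^w≈1))
  T-shift : ∀ y → T y ≈ pow R ζ w * T (σ y)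
  T-shift y = if-cong-⇔ R (uniform? y) (uniform? (σ y))
                (comp-map-uniform cyclicPred-injective cyclicPred-surjective y)
                (pow-dot-map-cyclicPred R (proj₁ isPrimitive) a y)
  ∑T≈ζ^w*∑T : ∑ⱽ R q n T ≈ pow R ζ w * ∑ⱽ R q n T
  ∑T≈ζ^w*∑T = begin
    ∑ⱽ R q n T                           ≈⟨ ∑ⱽ-cong R q n T-shift ⟩
    ∑ⱽ R q n (λ y → pow R ζ w * T (σ y))  ≈⟨ *-distribˡ-∑ⱽ R q n (pow R ζ w) (T ∘ σ) ⟨
    pow R ζ w * ∑ⱽ R q n (T ∘ σ)          ≈⟨ *-congˡ (∑ⱽ-map R cyclicPred (∑-cyclicPred R) n T) ⟩
    pow R ζ w * ∑ⱽ R q n T                ∎
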